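{- Let $G$ be a finite loopless directed multigraph with oriented edge set $\mathbb E(G)$ and let $q$ be a source of $G$ from which every vertex is reachable by a directed path. Let $\mathcal C_G^q\subseteq k[y_e:e\in\mathbb E(G)]$ be generated by the monomials $\prod_{e\in\mathbb E(A,A^c)}y_e$ for all nonempty $A\subseteq V(G)\setminus\{q\}$, and let $\Sigma_G^q$ be its Stanley–Reisner complex. Then $\Sigma_G^q$ is shellable.
   Context: $k$ is a field. $\mathbb E(A,B)$ denotes the set of oriented edges with head in $A$ and tail in $B$; $A^c=V(G)\setminus A$. A source means no oriented edge has head $q$. The Stanley–Reisner complex of a squarefree monomial ideal $I$ is the simplicial complex of sets $\tau$ of variables with $\prod_{y\in\tau}y\notin I$. -}

module Defs where

open import Data.Nat using (ℕ; _≤_; _∸_; _<_)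
open import Data.Fin using (Fin; toℕ)
open import Data.Fin.Subset using (Subset; _∈_; _∉_; _⊆_; ∣_∣; Nonempty)
open import Data.Product using (Σ; ∃; _×_; _,_)
open import Relation.Binary.PropositionalEquality using (_≡_; _≢_)
open import Relation.Nullary using (¬_)
open import Function.Definitions using (Injective)
open import Data.Bool using (Bool; true; false)
open import Data.Vec using (lookup)
import Data.Vec
import Data.Bool

record DiGraph : Set where
  field
    n     : ℕ
    m     : ℕ
    head  : Fin m → Fin n
    tail  : Fin m → Fin n
    loopless : ∀ e → head e ≢ tail e
open DiGraph public

IsSource : (G : DiGraph) → Fin (n G) → Set
IsSource G q = ∀ e → head G e ≢ q

data Reachable (G : DiGraph) (q : Fin (n G)) : Fin (n G) → Set where
  here : Reachable G q q
  step : ∀ e → Reachable G q (tail G e) → Reachable G q (head G e)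

Monomial : ℕ → Set
Monomial m = Fin m → ℕ

_∣ᵐ_ : ∀ {m} → Monomial m → Monomial m → Set
a ∣ᵐ b = ∀ i → a i ≤ b i

sqfree : ∀ {m} → Subset m → Monomial m
sqfree τ i with lookup τ i
... | true  = 1
... | false = 0

-- A monomial lies in the monomial ideal generated by a family of monomials
-- iff it is divisible by one of the generators.
InMonomialIdeal : ∀ {m} {I : Set} → (I → Monomial m) → Monomial m → Set
InMonomialIdeal {I = I} gen μ = Σ I λ a → gen a ∣ᵐ μ

GenIndex : (G : DiGraph) → Fin (n G) → Set
GenIndex G q = Σ (Subset (n G)) λ A → Nonempty A × q ∉ A

EdgeCut : (G : DiGraph) → Subset (n G) → Subset (m G)
EdgeCut G A = Data.Vec.tabulate λ e → lookup A (head G e) Data.Bool.∧ Data.Bool.not (lookup A (tail G e))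

cutMonomial : (G : DiGraph) (q : Fin (n G)) → GenIndex G q → Monomial (m G)
cutMonomial G q (A , _) = sqfree (EdgeCut G A)

SR : (G : DiGraph) (q : Fin (n G)) → Subset (m G) → Set
SR G q τ = ¬ InMonomialIdeal (cutMonomial G q) (sqfree τ)

-- Shellability (Björner–Wachs, possibly non-pure)
IsFacet : ∀ {m} → (Subset m → Set) → Subset m → Set
IsFacet Δ σ = Δ σ × (∀ τ → Δ τ → σ ⊆ τ → τ ≡ σ)

PureCard : ∀ {m} → (Subset m → Set) → ℕ → Set
PureCard K d = (∀ σ → K σ → ∣ σ ∣ ≤ d) × (∀ σ → K σ → ∃ λ τ → K τ × σ ⊆ τ × ∣ τ ∣ ≡ d)

Shellable : ∀ {m} → (Subset m → Set) → Set
Shellable {m} Δ =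
  Σ ℕ λ t → Σ (Fin t → Subset m) λ F →
    (∀ i → IsFacet Δ (F i)) ×
    (∀ σ → IsFacet Δ σ → ∃ λ i → F i ≡ σ) ×
    Injective _≡_ _≡_ F ×
    (∀ j → 0 < toℕ j →
       PureCard (λ σ → σ ⊆ F j × ∃ λ i → toℕ i < toℕ j × σ ⊆ F i) (∣ F j ∣ ∸ 1))

-- A set of edges is a face of Σ iff its complement meets every cut E(A, Aᶜ), i.e. iff it
-- avoids some spanning arborescence rooted at q, so the facets are the complements of these
-- arborescences. Record an arborescence T by its levelling, the matrix whose row k lists the
-- edges of T whose head has depth k, and list the arborescences in lexicographic order of
-- their levellings, an entry true coming before false. If T precedes T′ and (k, e) is the
-- first entry where they differ, then e ∈ T ∖ T′, and exchanging e for the edge f of T′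
-- entering the head of e gives an arborescence T″ = T′ − f + e. Since the head of e has depth
-- at least k in T′, every vertex of depth below k keeps its depth in T″; so T″ agrees with T′
-- before (k, e) and contains e there, i.e. T″ precedes T′. The facet of T″ contains the facet
-- of T′ minus e, which is the codimension-one face required by the shelling condition.

module Submission where

open import Defs
open import Data.Bool using (Bool; true; false; not; _∧_)
open import Data.Empty using (⊥; ⊥-elim)
open import Data.Fin using (Fin; zero; suc; toℕ; fromℕ<) renaming (_≟_ to _≟ᶠ_)
open import Data.Fin.Properties using (toℕ-injective; toℕ-fromℕ<; any?; all?; ¬∀⟶∃¬; <-cmp)
open import Data.Fin.Subset using (Subset; _∈_; _∉_; _⊆_; ∣_∣; Nonempty; ∁; ⁅_⁆; _∪_; _-_; ⊤; inside; outside) renaming (⊥ to ∅)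
open import Data.Fin.Subset.Properties
  using (_∈?_; ∈⊤; ∉⊥; p⊂q⇒∣p∣<∣q∣; p⊆q⇒∣p∣≤∣q∣; p⊆p∪q; x∈p∪q⁻; x∈p∪q⁺; x∈⁅x⁆; x∈⁅y⁆⇒x≡y; ∣⊤∣≡n; ∣⁅x⁆∣≡1;
         p─⊥≡p; p─q⊆p; x∈p∧x≢y⇒x∈p-y; ⊆-antisym; x∈∁p⇒x∉p; x∉∁p⇒x∈p; x∉p⇒x∈∁p; x∈p⇒x∉∁p)
open import Data.List using (List; []; _∷_; length; cartesianProductWith; filter)
import Data.List as List
open import Data.List.Membership.Propositional using () renaming (_∈_ to _∈ˡ_)
open import Data.List.Membership.Propositional.Properties using (∈-filter⁺; ∈-filter⁻; ∈-lookup)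
import Data.List.Relation.Unary.All as All
import Data.List.Relation.Unary.All.Properties as All
open import Data.List.Relation.Unary.AllPairs using (AllPairs; []; _∷_)
import Data.List.Relation.Unary.AllPairs as AllPairs
import Data.List.Relation.Unary.AllPairs.Properties as AllPairs
import Data.List.Relation.Unary.Any as Any
open import Data.List.Relation.Unary.Any.Properties using (cartesianProductWith⁺; lookup-index)
open import Data.Nat using (ℕ; zero; suc; pred; _≤_; _<_; z≤n; s≤s; _∸_; _+_)
import Data.Nat.Properties as ℕ
open import Data.Product using (∃; ∃₂; _×_; _,_; proj₁; proj₂)
open import Function using (_∘_)
open import Function.Definitions using (Injective)
open import Data.Sum using (_⊎_; inj₁; inj₂)
open import Data.Vec using (Vec; []; _∷_; here; there; lookup; updateAt; replicate)
open import Data.Vec.Properties using (lookup∘tabulate; []=⇒lookup; lookup⇒[]=; lookup∘updateAt; lookup∘updateAt′; lookup-replicate)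
open import Data.Vec.Relation.Binary.Lex.Strict using (Lex-<; this; next)
import Data.Vec as Vec
open import Relation.Binary.PropositionalEquality using (_≡_; _≢_; refl; sym; trans; cong; cong₂; subst; subst₂; setoid; module ≡-Reasoning)
open import Relation.Binary.Definitions using (tri<; tri≈; tri>)
open import Relation.Nullary using (¬_; Dec; yes; no; does)
open import Relation.Nullary.Decidable using (_×-dec_; _⊎-dec_; _→-dec_; ¬?; dec-true; map′)

subset : ∀ {k} {P : Fin k → Set} → (∀ x → Dec (P x)) → Subset k
subset P? = Vec.tabulate (λ x → does (P? x))

∈-subset⁺ : ∀ {k} {P : Fin k → Set} (P? : ∀ x → Dec (P x)) {x} → P x → x ∈ subset P?
∈-subset⁺ P? {x} px = lookup⇒[]= x _ (trans (lookup∘tabulate _ x) (dec-true (P? x) px))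

∈-subset⁻ : ∀ {k} {P : Fin k → Set} (P? : ∀ x → Dec (P x)) {x} → x ∈ subset P? → P x
∈-subset⁻ P? {x} x∈ with P? x | trans (sym (lookup∘tabulate _ x)) ([]=⇒lookup x∈)
... | yes px | _ = px
... | no _   | ()

∉⇒lookup≡false : ∀ {k} {p : Subset k} {x} → x ∉ p → lookup p x ≡ false
∉⇒lookup≡false {p = p} {x} x∉p with lookup p x in eq
... | true  = ⊥-elim (x∉p (lookup⇒[]= x p eq))
... | false = refl

lookup≡false⇒∉ : ∀ {k} {p : Subset k} {x} → lookup p x ≡ false → x ∉ p
lookup≡false⇒∉ eq x∈p with trans (sym ([]=⇒lookup x∈p)) eq
... | ()

∈-resp-lookup : ∀ {k} {p p′ : Subset k} {x} → lookup p x ≡ lookup p′ x → x ∈ p → x ∈ p′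
∈-resp-lookup {p′ = p′} {x} eq x∈p = lookup⇒[]= x p′ (trans (sym eq) ([]=⇒lookup x∈p))

lookup-ext : ∀ {k} {p p′ : Subset k} {x} → (x ∈ p → x ∈ p′) → (x ∈ p′ → x ∈ p) → lookup p x ≡ lookup p′ x
lookup-ext {p = p} {p′} {x} to from with lookup p x in eq | lookup p′ x in eq′
... | true  | true  = refl
... | false | false = refl
... | true  | false = sym (trans (sym eq′) ([]=⇒lookup (to (lookup⇒[]= x p eq))))
... | false | true  = trans (sym eq) ([]=⇒lookup (from (lookup⇒[]= x p′ eq′)))

∉⇒∣p∣<n : ∀ {k} {p : Subset k} {x} → x ∉ p → ∣ p ∣ < k
∉⇒∣p∣<n {k} {p} {x} x∉p = subst (∣ p ∣ <_) (∣⊤∣≡n k) (p⊂q⇒∣p∣<∣q∣ ((λ _ → ∈⊤) , x , ∈⊤ , x∉p))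

x∉p-x : ∀ {k} (p : Subset k) x → x ∉ p - x
x∉p-x (_ ∷ p) zero    ()
x∉p-x (_ ∷ p) (suc x) (there x∈) = x∉p-x p x x∈

x∈p⇒∣p-x∣≡∣p∣∸1 : ∀ {k} {p : Subset k} {x} → x ∈ p → ∣ p - x ∣ ≡ ∣ p ∣ ∸ 1
x∈p⇒∣p-x∣≡∣p∣∸1 x∈p = cong (_∸ 1) (suc∣p-x∣≡∣p∣ x∈p)
  where
  suc∣p-x∣≡∣p∣ : ∀ {k} {p : Subset k} {x} → x ∈ p → suc ∣ p - x ∣ ≡ ∣ p ∣
  suc∣p-x∣≡∣p∣ {p = inside ∷ p} here = cong (λ r → suc ∣ r ∣) (p─⊥≡p p)
  suc∣p-x∣≡∣p∣ {p = inside ∷ p} (there x∈p) = cong suc (suc∣p-x∣≡∣p∣ x∈p)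
  suc∣p-x∣≡∣p∣ {p = outside ∷ p} (there x∈p) = suc∣p-x∣≡∣p∣ x∈p

AllPairs-lookup : ∀ {X : Set} {R : X → X → Set} {xs : List X} → AllPairs R xs →
  ∀ {i j} → toℕ i < toℕ j → R (List.lookup xs i) (List.lookup xs j)
AllPairs-lookup (r ∷ _)  {zero}  {suc j} _         = All.lookup r (∈-lookup j)
AllPairs-lookup (_ ∷ rs) {suc i} {suc j} (s≤s i<j) = AllPairs-lookup rs i<j

module LexicographicEnumeration {X : Set} (_≺_ : X → X → Set) where

  _<ₗₑₓ_ : ∀ {k} → Vec X k → Vec X k → Set
  _<ₗₑₓ_ = Lex-< _≡_ _≺_

  vectors : List X → (k : ℕ) → List (Vec X k)
  vectors xs zero    = [] ∷ []
  vectors xs (suc k) = cartesianProductWith _∷_ xs (vectors xs k)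

  ∈-vectors : ∀ {xs} → (∀ x → x ∈ˡ xs) → ∀ {k} (v : Vec X k) → v ∈ˡ vectors xs k
  ∈-vectors complete []      = Any.here refl
  ∈-vectors complete (x ∷ v) = cartesianProductWith⁺ _∷_ (cong₂ _∷_) (complete x) (∈-vectors complete v)

  vectors-sorted : ∀ {xs} → AllPairs _≺_ xs → ∀ k → AllPairs _<ₗₑₓ_ (vectors xs k)
  vectors-sorted sorted zero    = All.[] ∷ []
  vectors-sorted sorted (suc k) = prepend-sorted sorted (vectors-sorted sorted k)
    where
    prepend-sorted : ∀ {xs} {ys : List (Vec X k)} → AllPairs _≺_ xs → AllPairs _<ₗₑₓ_ ys →
      AllPairs _<ₗₑₓ_ (cartesianProductWith _∷_ xs ys)
    prepend-sorted [] _ = []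
    prepend-sorted {x ∷ xs} {ys} (x≺xs ∷ xs-sorted) ys-sorted =
      AllPairs.++⁺ (AllPairs.map⁺ (AllPairs.map (next refl) ys-sorted))
                   (prepend-sorted xs-sorted ys-sorted)
                   (All.map⁺ (All.universal
                     (λ _ → All.cartesianProductWith⁺ (setoid X) (setoid (Vec X k)) _∷_ xs ys
                              (λ x′∈xs _ → this (All.lookup x≺xs x′∈xs) refl))
                     ys))

  first-difference : ∀ {k} {xs ys : Vec X k} → xs <ₗₑₓ ys →
    ∃ λ i → (∀ j → toℕ j < toℕ i → lookup xs j ≡ lookup ys j) × lookup xs i ≺ lookup ys i
  first-difference (this x≺y _) = zero , (λ _ ()) , x≺y
  first-difference {xs = x ∷ xs} {_ ∷ ys} (next refl xs<ys) with first-difference xs<ys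
  ... | i , agree , ≺ = suc i , agree′ , ≺
    where
    agree′ : ∀ j → toℕ j < suc (toℕ i) → lookup (x ∷ xs) j ≡ lookup (x ∷ ys) j
    agree′ zero    _         = refl
    agree′ (suc j) (s≤s j<i) = agree j j<i

sqfree-∈ : ∀ {k} {τ : Subset k} {x} → x ∈ τ → sqfree τ x ≡ 1
sqfree-∈ {τ = τ} {x} x∈τ rewrite []=⇒lookup x∈τ = refl

sqfree-∉ : ∀ {k} {τ : Subset k} {x} → x ∉ τ → sqfree τ x ≡ 0
sqfree-∉ {τ = τ} {x} x∉τ rewrite ∉⇒lookup≡false x∉τ = refl

sqfree-mono : ∀ {k} {τ σ : Subset k} → τ ⊆ σ → sqfree τ ∣ᵐ sqfree σ
sqfree-mono {τ = τ} τ⊆σ x with x ∈? τ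
... | yes x∈τ = ℕ.≤-reflexive (trans (sqfree-∈ x∈τ) (sym (sqfree-∈ (τ⊆σ x∈τ))))
... | no  x∉τ = subst (_≤ _) (sym (sqfree-∉ x∉τ)) z≤n

sqfree-∣⇒⊆ : ∀ {k} {τ σ : Subset k} → sqfree τ ∣ᵐ sqfree σ → τ ⊆ σ
sqfree-∣⇒⊆ {σ = σ} τ∣σ {x} x∈τ with x ∈? σ
... | yes x∈σ = x∈σ
... | no  x∉σ = ⊥-elim (ℕ.1+n≰n (subst₂ _≤_ (sqfree-∈ x∈τ) (sqfree-∉ x∉σ) (τ∣σ x)))

module Cuts (G : DiGraph) (q : Fin (n G)) where

  MeetsEveryCut : (Fin (m G) → Set) → Set
  MeetsEveryCut P = ∀ A → Nonempty A → q ∉ A → ∃ λ g → P g × head G g ∈ A × tail G g ∉ A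

  ∈-EdgeCut⁺ : ∀ {A g} → head G g ∈ A → tail G g ∉ A → g ∈ EdgeCut G A
  ∈-EdgeCut⁺ {A} {g} h∈A t∉A = lookup⇒[]= g _ (begin
    lookup (EdgeCut G A) g                                       ≡⟨ lookup∘tabulate _ g ⟩
    lookup A (head G g) ∧ not (lookup A (tail G g))              ≡⟨ cong₂ (λ a b → a ∧ not b) ([]=⇒lookup h∈A) (∉⇒lookup≡false t∉A) ⟩
    true                                                         ∎)
    where open ≡-Reasoning

  ∈-EdgeCut⁻ : ∀ {A g} → g ∈ EdgeCut G A → head G g ∈ A × tail G g ∉ A
  ∈-EdgeCut⁻ {A} {g} g∈cut
    with lookup A (head G g) in h | lookup A (tail G g) in t | trans (sym (lookup∘tabulate _ g)) ([]=⇒lookup g∈cut)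
  ... | true | false | _ = lookup⇒[]= _ A h , lookup≡false⇒∉ t

  face⇒meets-every-cut : ∀ {σ} → SR G q σ → MeetsEveryCut (_∉ σ)
  face⇒meets-every-cut {σ} face A ne q∉A
    with any? (λ g → ¬? (g ∈? σ) ×-dec (head G g ∈? A) ×-dec ¬? (tail G g ∈? A))
  ... | yes crossing = crossing
  ... | no ¬crossing = ⊥-elim (face ((A , ne , q∉A) , sqfree-mono cut⊆σ))
    where
    cut⊆σ : EdgeCut G A ⊆ σ
    cut⊆σ {g} g∈cut with g ∈? σ
    ... | yes g∈σ = g∈σ
    ... | no  g∉σ = ⊥-elim (¬crossing (g , g∉σ , ∈-EdgeCut⁻ g∈cut))

  meets-every-cut⇒face : ∀ {σ} → MeetsEveryCut (_∉ σ) → SR G q σ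
  meets-every-cut⇒face meets ((A , ne , q∉A) , cut∣σ) with meets A ne q∉A
  ... | g , g∉σ , h∈A , t∉A = g∉σ (sqfree-∣⇒⊆ cut∣σ (∈-EdgeCut⁺ h∈A t∉A))

module Arborescences (G : DiGraph) (q : Fin (n G)) (q-source : IsSource G q) where
  open Cuts G q

  private
    N = n G
    M = m G
    hd = head G
    tl = tail G

  Levelling : Set
  Levelling = Vec (Subset M) N

  _∈[_]_ : Fin M → Fin N → Levelling → Set
  e ∈[ k ] K = e ∈ lookup K k

  Uses : Levelling → Fin M → Set
  Uses K e = ∃ λ k → e ∈[ k ] K

  uses? : ∀ K e → Dec (Uses K e)
  uses? K e = any? (λ k → e ∈? lookup K k)

  data Depth (K : Levelling) (w : Fin N) (d : ℕ) : Set where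
    root  : w ≡ q → d ≡ 0 → Depth K w d
    below : ∀ {k e} → e ∈[ k ] K → hd e ≡ w → toℕ k ≡ d → Depth K w d

  record IsLevelled (K : Levelling) : Set where
    field
      in-unique : ∀ {k k′ e e′} → e ∈[ k ] K → e′ ∈[ k′ ] K → hd e ≡ hd e′ → k ≡ k′ × e ≡ e′
      parent    : ∀ {k e} → e ∈[ k ] K → ∃ λ d → toℕ k ≡ suc d × Depth K (tl e) d

  Covers : Levelling → Set
  Covers K = ∀ w → w ≢ q → ∃₂ λ k e → e ∈[ k ] K × hd e ≡ w

  record IsArborescence (K : Levelling) : Set where
    field
      levelled : IsLevelled K
      covers   : Covers K
    open IsLevelled levelled public

  HeadInjective : (Fin M → Set) → Set
  HeadInjective P = ∀ {g g′} → P g → P g′ → hd g ≡ hd g′ → g ≡ g′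

  Depth-mono : ∀ {K K′ w d} → (∀ {k e} → e ∈[ k ] K → e ∈[ k ] K′) → Depth K w d → Depth K′ w d
  Depth-mono _   (root w≡q d≡0)  = root w≡q d≡0
  Depth-mono K⊑K′ (below e∈ h k≡) = below (K⊑K′ e∈) h k≡

  module _ {K : Levelling} (levelled : IsLevelled K) where
    open IsLevelled levelled

    level-unique : ∀ {k k′ e} → e ∈[ k ] K → e ∈[ k′ ] K → k ≡ k′
    level-unique e∈ e∈′ = proj₁ (in-unique e∈ e∈′ refl)

    uses-head-injective : HeadInjective (Uses K)
    uses-head-injective (_ , g∈) (_ , g′∈) h = proj₂ (in-unique g∈ g′∈ h)

    depth-unique : ∀ {w d d′} → Depth K w d → Depth K w d′ → d ≡ d′
    depth-unique (root _ d≡0)   (root _ d′≡0)           = trans d≡0 (sym d′≡0)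
    depth-unique (root w≡q _)   (below {e = e} _ h _)   = ⊥-elim (q-source e (trans h w≡q))
    depth-unique (below {e = e} _ h _) (root w≡q _)     = ⊥-elim (q-source e (trans h w≡q))
    depth-unique (below e∈ h k≡) (below e′∈ h′ k′≡) with in-unique e∈ e′∈ (trans h (sym h′))
    ... | refl , refl = trans (sym k≡) k′≡

    level≡1+tail-depth : ∀ {k e d} → e ∈[ k ] K → Depth K (tl e) d → toℕ k ≡ suc d
    level≡1+tail-depth e∈ tail-depth with parent e∈
    ... | _ , k≡ , tail-depth′ = trans k≡ (cong suc (depth-unique tail-depth′ tail-depth))

    crossing-edge-below : ∀ {A} → q ∉ A → ∀ d {w} → Depth K w d → w ∈ A →
      ∃₂ λ k g → g ∈[ k ] K × toℕ k ≤ d × hd g ∈ A × tl g ∉ A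
    crossing-edge-below q∉A _ (root refl _) q∈A = ⊥-elim (q∉A q∈A)
    crossing-edge-below q∉A zero (below g∈ _ k≡0) _ with parent g∈
    ... | _ , k≡suc , _ = ⊥-elim (ℕ.0≢1+n (trans (sym k≡0) k≡suc))
    crossing-edge-below {A} q∉A (suc d) (below {k} {g} g∈ refl k≡) w∈A with tl g ∈? A
    ... | no t∉A = k , g , g∈ , ℕ.≤-reflexive k≡ , w∈A , t∉A
    ... | yes t∈A with parent g∈
    ... | _ , k≡suc , tail-depth
      with crossing-edge-below q∉A d (subst (Depth K (tl g)) (ℕ.suc-injective (trans (sym k≡suc) k≡)) tail-depth) t∈A
    ... | k′ , g′ , g′∈ , k′≤d , crosses = k′ , g′ , g′∈ , ℕ.m≤n⇒m≤1+n k′≤d , crosses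

  module _ {K : Levelling} (arb : IsArborescence K) where
    open IsArborescence arb

    depth-exists : ∀ w → ∃ (Depth K w)
    depth-exists w with w ≟ᶠ q
    ... | yes w≡q = 0 , root w≡q refl
    ... | no  w≢q with covers w w≢q
    ... | k , e , e∈ , h = toℕ k , below e∈ h refl

    meets-every-cut : MeetsEveryCut (Uses K)
    meets-every-cut A (a , a∈A) q∉A with depth-exists a
    ... | d , a-depth with crossing-edge-below levelled q∉A d a-depth a∈A
    ... | k , g , g∈ , _ , crosses = g , (k , g∈) , crosses

  uses-all-of-head-injective : ∀ {K P} → Covers K → (∀ {k g} → g ∈[ k ] K → P g) → HeadInjective P →
    ∀ {g} → P g → Uses K g
  uses-all-of-head-injective {K} covers within injective {g} pg with covers (hd g) (q-source g)
  ... | k , g′ , g′∈ , h = subst (Uses K) (injective (within g′∈) pg h) (k , g′∈)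

  insert : Levelling → Fin N → Fin M → Levelling
  insert K k g = updateAt K k (⁅ g ⁆ ∪_)

  module _ {K : Levelling} {k : Fin N} {g : Fin M} where

    ∈-insert-new : g ∈[ k ] insert K k g
    ∈-insert-new = subst (g ∈_) (sym (lookup∘updateAt k K)) (x∈p∪q⁺ (inj₁ (x∈⁅x⁆ g)))

    ∈-insert-old : ∀ {j e} → e ∈[ j ] K → e ∈[ j ] insert K k g
    ∈-insert-old {j} e∈ with j ≟ᶠ k
    ... | yes refl = subst (_ ∈_) (sym (lookup∘updateAt k K)) (x∈p∪q⁺ (inj₂ e∈))
    ... | no  j≢k  = subst (_ ∈_) (sym (lookup∘updateAt′ j k j≢k K)) e∈

    ∈-insert⁻ : ∀ {j e} → e ∈[ j ] insert K k g → e ∈[ j ] K ⊎ (j ≡ k × e ≡ g)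
    ∈-insert⁻ {j} {e} e∈ with j ≟ᶠ k
    ... | no  j≢k  = inj₁ (subst (e ∈_) (lookup∘updateAt′ j k j≢k K) e∈)
    ... | yes refl with x∈p∪q⁻ ⁅ g ⁆ (lookup K k) (subst (e ∈_) (lookup∘updateAt k K) e∈)
    ...   | inj₁ e∈⁅g⁆ = inj₂ (refl , x∈⁅y⁆⇒x≡y g e∈⁅g⁆)
    ...   | inj₂ e∈K   = inj₁ e∈K

    insert-levelled : ∀ {d} → IsLevelled K → (∀ {j e} → e ∈[ j ] K → hd e ≢ hd g) →
      Depth K (tl g) d → toℕ k ≡ suc d → IsLevelled (insert K k g)
    insert-levelled {d} levelled fresh tail-depth k≡ = record { in-unique = in-unique′ ; parent = parent′ }
      where
      open IsLevelled levelled
      in-unique′ : ∀ {j j′ e e′} → e ∈[ j ] insert K k g → e′ ∈[ j′ ] insert K k g → hd e ≡ hd e′ →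
        j ≡ j′ × e ≡ e′
      in-unique′ e∈ e′∈ h with ∈-insert⁻ e∈ | ∈-insert⁻ e′∈
      ... | inj₁ e∈K         | inj₁ e′∈K         = in-unique e∈K e′∈K h
      ... | inj₂ (refl , refl) | inj₂ (refl , refl) = refl , refl
      ... | inj₁ e∈K         | inj₂ (refl , refl) = ⊥-elim (fresh e∈K h)
      ... | inj₂ (refl , refl) | inj₁ e′∈K        = ⊥-elim (fresh e′∈K (sym h))
      parent′ : ∀ {j e} → e ∈[ j ] insert K k g → ∃ λ d → toℕ j ≡ suc d × Depth (insert K k g) (tl e) d
      parent′ e∈ with ∈-insert⁻ e∈
      ... | inj₁ e∈K with parent e∈K
      ...   | d′ , j≡ , depth = d′ , j≡ , Depth-mono ∈-insert-old depth
      parent′ e∈ | inj₂ (refl , refl) = d , k≡ , Depth-mono ∈-insert-old tail-depth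

  module Growing {P : Fin M → Set} (P-meets : MeetsEveryCut P) where

    record Partial (K : Levelling) (R : Subset N) : Set where
      field
        levelled : IsLevelled K
        within   : ∀ {k e} → e ∈[ k ] K → P e
        root∈    : q ∈ R
        heads∈   : ∀ {k e} → e ∈[ k ] K → hd e ∈ R
        reached  : ∀ {w} → w ∈ R → ∃ λ d → d < ∣ R ∣ × Depth K w d

    extend : ∀ {K R v} → Partial K R → v ∉ R → ∃₂ λ K′ R′ → Partial K′ R′ × ∣ R ∣ < ∣ R′ ∣
    extend {K} {R} {v} partial v∉R with P-meets (∁ R) (v , x∉p⇒x∈∁p v∉R) (x∈p⇒x∉∁p (Partial.root∈ partial))
    ... | g , pg , hg∈∁R , tg∉∁R with Partial.reached partial (x∉∁p⇒x∈p tg∉∁R)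
    ... | d , d<∣R∣ , tail-depth = insert K k g , R′ , partial′ , ∣R∣<∣R′∣
      where
      open Partial partial
      hg∉R : hd g ∉ R
      hg∉R = x∈∁p⇒x∉p hg∈∁R
      R′ : Subset N
      R′ = R ∪ ⁅ hd g ⁆
      hg∈R′ : hd g ∈ R′
      hg∈R′ = x∈p∪q⁺ (inj₂ (x∈⁅x⁆ (hd g)))
      ∣R∣<∣R′∣ : ∣ R ∣ < ∣ R′ ∣
      ∣R∣<∣R′∣ = p⊂q⇒∣p∣<∣q∣ (p⊆p∪q ⁅ hd g ⁆ , hd g , hg∈R′ , hg∉R)
      1+d<N : suc d < N
      1+d<N = ℕ.≤-<-trans d<∣R∣ (∉⇒∣p∣<n hg∉R)
      k : Fin N
      k = fromℕ< 1+d<N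
      within′ : ∀ {j e} → e ∈[ j ] insert K k g → P e
      within′ e∈ with ∈-insert⁻ {K} {k} {g} e∈
      ... | inj₁ e∈K           = within e∈K
      ... | inj₂ (refl , refl) = pg
      heads∈′ : ∀ {j e} → e ∈[ j ] insert K k g → hd e ∈ R′
      heads∈′ e∈ with ∈-insert⁻ {K} {k} {g} e∈
      ... | inj₁ e∈K           = p⊆p∪q ⁅ hd g ⁆ (heads∈ e∈K)
      ... | inj₂ (refl , refl) = hg∈R′
      reached′ : ∀ {w} → w ∈ R′ → ∃ λ d → d < ∣ R′ ∣ × Depth (insert K k g) w d
      reached′ {w} w∈R′ with x∈p∪q⁻ R ⁅ hd g ⁆ w∈R′
      ... | inj₁ w∈R with reached w∈R
      ...   | d′ , d′<∣R∣ , depth = d′ , ℕ.<-trans d′<∣R∣ ∣R∣<∣R′∣ , Depth-mono (∈-insert-old {K} {k} {g}) depth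
      reached′ {w} w∈R′ | inj₂ w∈⁅hg⁆ =
        suc d , ℕ.≤-<-trans d<∣R∣ ∣R∣<∣R′∣ , below (∈-insert-new {K} {k} {g}) (sym (x∈⁅y⁆⇒x≡y (hd g) w∈⁅hg⁆)) (toℕ-fromℕ< 1+d<N)
      partial′ : Partial (insert K k g) R′
      partial′ = record
        { levelled = insert-levelled levelled (λ e∈ h → hg∉R (subst (_∈ R) h (heads∈ e∈))) tail-depth (toℕ-fromℕ< 1+d<N)
        ; within   = within′
        ; root∈    = p⊆p∪q ⁅ hd g ⁆ root∈
        ; heads∈   = heads∈′
        ; reached  = reached′
        }

    complete : ∀ fuel {K R} → Partial K R → N ≤ fuel + ∣ R ∣ →
      ∃ λ K → IsArborescence K × (∀ {k e} → e ∈[ k ] K → P e)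
    complete fuel {K} {R} partial N≤ with all? (_∈? R)
    ... | yes all∈R = K , record { levelled = levelled ; covers = covers } , within
      where
      open Partial partial
      covers : Covers K
      covers w w≢q with reached (all∈R w)
      ... | _ , _ , root w≡q _   = ⊥-elim (w≢q w≡q)
      ... | _ , _ , below e∈ h _ = _ , _ , e∈ , h
    ... | no ¬all∈R with ¬∀⟶∃¬ N (_∈ R) (_∈? R) ¬all∈R
    ... | v , v∉R with fuel | extend partial v∉R
    ...   | zero     | _ = ⊥-elim (ℕ.<-irrefl refl (ℕ.<-≤-trans (∉⇒∣p∣<n v∉R) N≤))
    ...   | suc fuel | _ , R′ , partial′ , ∣R∣<∣R′∣ =
      complete fuel partial′ (ℕ.≤-trans N≤ (ℕ.≤-trans (ℕ.≤-reflexive (sym (ℕ.+-suc fuel ∣ R ∣))) (ℕ.+-monoʳ-≤ fuel ∣R∣<∣R′∣)))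

    ∉empty : ∀ {k : Fin N} {e : Fin M} → e ∉ lookup (replicate N ∅) k
    ∉empty {k} e∈ = ∉⊥ (subst (_ ∈_) (lookup-replicate k ∅) e∈)

    start : Partial (replicate N ∅) ⁅ q ⁆
    start = record
      { levelled = record { in-unique = λ e∈ → ⊥-elim (∉empty e∈) ; parent = λ e∈ → ⊥-elim (∉empty e∈) }
      ; within   = λ e∈ → ⊥-elim (∉empty e∈)
      ; root∈    = x∈⁅x⁆ q
      ; heads∈   = λ e∈ → ⊥-elim (∉empty e∈)
      ; reached  = λ w∈ → 0 , subst (0 <_) (sym (∣⁅x⁆∣≡1 q)) (s≤s z≤n) , root (x∈⁅y⁆⇒x≡y q w∈) refl
      }

    grow : ∃ λ K → IsArborescence K × (∀ {k e} → e ∈[ k ] K → P e)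
    grow = complete N start (ℕ.m≤m+n N _)

  unused : Levelling → Subset M
  unused K = subset (λ e → ¬? (uses? K e))

  ∈-unused⁺ : ∀ K {e} → ¬ Uses K e → e ∈ unused K
  ∈-unused⁺ K = ∈-subset⁺ (λ e → ¬? (uses? K e))

  ∈-unused⁻ : ∀ K {e} → e ∈ unused K → ¬ Uses K e
  ∈-unused⁻ K = ∈-subset⁻ (λ e → ¬? (uses? K e))

  ∉-unused⁻ : ∀ K {e} → e ∉ unused K → Uses K e
  ∉-unused⁻ K {e} e∉ with uses? K e
  ... | yes uses = uses
  ... | no ¬uses = ⊥-elim (e∉ (∈-unused⁺ K ¬uses))

  module _ {K : Levelling} (arb : IsArborescence K) where
    open IsArborescence arb

    unused-face : SR G q (unused K)
    unused-face = meets-every-cut⇒face avoids-unused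
      where
      avoids-unused : MeetsEveryCut (_∉ unused K)
      avoids-unused A ne q∉A with meets-every-cut arb A ne q∉A
      ... | g , uses , crosses = g , (λ g∈ → ∈-unused⁻ K g∈ uses) , crosses

    unused-maximal : ∀ {τ} → SR G q τ → unused K ⊆ τ → τ ⊆ unused K
    unused-maximal {τ} face unused⊆τ {x} x∈τ with uses? K x
    ... | no ¬uses = ∈-unused⁺ K ¬uses
    ... | yes uses with Growing.grow (face⇒meets-every-cut face)
    ... | K₀ , arb₀ , avoids-τ with uses-all-of-head-injective {K₀} (IsArborescence.covers arb₀) within-K
                                      (uses-head-injective levelled) uses
      where
      within-K : ∀ {j g} → g ∈[ j ] K₀ → Uses K g
      within-K g∈ = ∉-unused⁻ K (λ g∈unused → avoids-τ g∈ (unused⊆τ g∈unused))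
    ... | _ , x∈K₀ = ⊥-elim (avoids-τ x∈K₀ x∈τ)

    unused-facet : IsFacet (SR G q) (unused K)
    unused-facet = unused-face , λ τ face unused⊆τ → ⊆-antisym (unused-maximal face unused⊆τ) unused⊆τ

  facet⇒unused : ∀ {σ} → IsFacet (SR G q) σ → ∃ λ K → IsArborescence K × unused K ≡ σ
  facet⇒unused {σ} (face , maximal) with Growing.grow (face⇒meets-every-cut face)
  ... | K , arb , avoids-σ = K , arb , maximal (unused K) (unused-face arb) σ⊆unused
    where
    σ⊆unused : σ ⊆ unused K
    σ⊆unused x∈σ = ∈-unused⁺ K λ { (_ , x∈K) → avoids-σ x∈K x∈σ }

  module _ {K₁ K₂ : Levelling} (levelled₁ : IsLevelled K₁) (levelled₂ : IsLevelled K₂) where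
    open IsLevelled levelled₁ using (parent)

    entry-transfer : ∀ {j g} → (∀ {d w} → d < toℕ j → Depth K₁ w d → Depth K₂ w d) →
      g ∈[ j ] K₁ → Uses K₂ g → g ∈[ j ] K₂
    entry-transfer {j} {g} transfer g∈ (i , g∈₂) with parent g∈
    ... | d , j≡ , tail-depth = subst (λ i → g ∈[ i ] K₂) i≡j g∈₂
      where
      i≡j : i ≡ j
      i≡j = toℕ-injective (trans (level≡1+tail-depth levelled₂ g∈₂ (transfer (ℕ.≤-reflexive (sym j≡)) tail-depth)) (sym j≡))

    module _ {b : ℕ} (shared : ∀ {j g} → toℕ j < b → g ∈[ j ] K₁ → Uses K₂ g) where

      depth-transfer : ∀ {d w} → d < b → Depth K₁ w d → Depth K₂ w d
      depth-transfer _ (root w≡q d≡0) = root w≡q d≡0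
      depth-transfer {zero} _ (below g∈ _ j≡0) with parent g∈
      ... | _ , j≡suc , _ = ⊥-elim (ℕ.0≢1+n (trans (sym j≡0) j≡suc))
      depth-transfer {suc d} 1+d<b (below {j} {g} g∈ h j≡) with parent g∈ | shared (subst (_< b) (sym j≡) 1+d<b) g∈
      ... | d′ , j≡suc , tail-depth | i , g∈₂ = below (subst (λ i → g ∈[ i ] K₂) i≡j g∈₂) h j≡
        where
        tail-depth₂ : Depth K₂ (tl g) d
        tail-depth₂ = depth-transfer (ℕ.<-trans (ℕ.n<1+n d) 1+d<b)
                        (subst (Depth K₁ (tl g)) (ℕ.suc-injective (trans (sym j≡suc) j≡)) tail-depth)
        i≡j : i ≡ j
        i≡j = toℕ-injective (trans (level≡1+tail-depth levelled₂ g∈₂ tail-depth₂) (sym j≡))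

      entries-transfer-below : ∀ {j g} → toℕ j < b → g ∈[ j ] K₁ → g ∈[ j ] K₂
      entries-transfer-below j<b g∈ = entry-transfer (λ d<j → depth-transfer (ℕ.<-trans d<j j<b)) g∈ (shared j<b g∈)

  record FirstDifference (K K′ : Levelling) (k : Fin N) (e : Fin M) : Set where
    field
      rows-agree    : ∀ j → toℕ j < toℕ k → lookup K j ≡ lookup K′ j
      entries-agree : ∀ x → toℕ x < toℕ e → lookup (lookup K k) x ≡ lookup (lookup K′ k) x
      e∈K           : e ∈[ k ] K
      e∉K′          : e ∉ lookup K′ k

  private
    module FD = FirstDifference

  first-difference-asym : ∀ {K K′ k k′ e e′} → FirstDifference K K′ k e → FirstDifference K′ K k′ e′ → ⊥
  first-difference-asym {k = k} {k′} {e} {e′} d d′ with <-cmp k k′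
  ... | tri< k<k′ _ _ = FD.e∉K′ d (subst (e ∈_) (sym (FD.rows-agree d′ k k<k′)) (FD.e∈K d))
  ... | tri> _ _ k′<k = FD.e∉K′ d′ (subst (e′ ∈_) (sym (FD.rows-agree d k′ k′<k)) (FD.e∈K d′))
  ... | tri≈ _ refl _ with <-cmp e e′
  ...   | tri< e<e′ _ _ = FD.e∉K′ d (∈-resp-lookup (sym (FD.entries-agree d′ e e<e′)) (FD.e∈K d))
  ...   | tri> _ _ e′<e = FD.e∉K′ d′ (∈-resp-lookup (sym (FD.entries-agree d e′ e′<e)) (FD.e∈K d′))
  ...   | tri≈ _ refl _ = FD.e∉K′ d′ (FD.e∈K d)

  module Exchange {K K′ : Levelling} (arb : IsArborescence K) (arb′ : IsArborescence K′)
                  {k : Fin N} {e : Fin M} (diff : FirstDifference K K′ k e) where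
    open FirstDifference diff
    private
      module A  = IsArborescence arb
      module A′ = IsArborescence arb′

    K→K′-below : ∀ {j x} → toℕ j < toℕ k → x ∈[ j ] K → x ∈[ j ] K′
    K→K′-below {j} j<k = subst (_ ∈_) (rows-agree j j<k)

    K′→K-below : ∀ {j x} → toℕ j < toℕ k → x ∈[ j ] K′ → x ∈[ j ] K
    K′→K-below {j} j<k = subst (_ ∈_) (sym (rows-agree j j<k))

    K→K′-depth : ∀ {d w} → d < toℕ k → Depth K w d → Depth K′ w d
    K→K′-depth = depth-transfer A.levelled A′.levelled (λ j<k x∈ → _ , K→K′-below j<k x∈)

    parent-of-e : ∃ λ d → toℕ k ≡ suc d × Depth K (tl e) d
    parent-of-e = A.parent e∈K

    d : ℕ
    d = proj₁ parent-of-e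

    k≡1+d : toℕ k ≡ suc d
    k≡1+d = proj₁ (proj₂ parent-of-e)

    d<k : d < toℕ k
    d<k = ℕ.≤-reflexive (sym k≡1+d)

    tail-e-depth′ : Depth K′ (tl e) d
    tail-e-depth′ = K→K′-depth d<k (proj₂ (proj₂ parent-of-e))

    e-unused : ¬ Uses K′ e
    e-unused (i , e∈K′) = e∉K′ (subst (λ i → e ∈[ i ] K′) i≡k e∈K′)
      where
      i≡k : i ≡ k
      i≡k = toℕ-injective (trans (level≡1+tail-depth A′.levelled e∈K′ tail-e-depth′) (sym k≡1+d))

    edge-into-head-e : ∃₂ λ kf f → f ∈[ kf ] K′ × hd f ≡ hd e
    edge-into-head-e = A′.covers (hd e) (q-source e)

    kf : Fin N
    kf = proj₁ edge-into-head-e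

    f : Fin M
    f = proj₁ (proj₂ edge-into-head-e)

    f∈K′ : f ∈[ kf ] K′
    f∈K′ = proj₁ (proj₂ (proj₂ edge-into-head-e))

    hf≡he : hd f ≡ hd e
    hf≡he = proj₂ (proj₂ (proj₂ edge-into-head-e))

    f≢e : f ≢ e
    f≢e f≡e = e-unused (kf , subst (λ x → x ∈[ kf ] K′) f≡e f∈K′)

    k≤kf : toℕ k ≤ toℕ kf
    k≤kf = ℕ.≮⇒≥ λ kf<k → f≢e (proj₂ (A.in-unique (K′→K-below kf<k f∈K′) e∈K hf≡he))

    below-k⇒≢f : ∀ {j g} → toℕ j < toℕ k → g ∈[ j ] K′ → g ≢ f
    below-k⇒≢f j<k g∈ refl = ℕ.<-irrefl (cong toℕ (level-unique A′.levelled g∈ f∈K′)) (ℕ.<-≤-trans j<k k≤kf)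

    Exchanged : Fin M → Set
    Exchanged g = (Uses K′ g × g ≢ f) ⊎ g ≡ e

    exchanged-head-injective : HeadInjective Exchanged
    exchanged-head-injective (inj₁ (uses₁ , _)) (inj₁ (uses₂ , _)) h = uses-head-injective A′.levelled uses₁ uses₂ h
    exchanged-head-injective (inj₁ (uses₁ , g≢f)) (inj₂ refl) h =
      ⊥-elim (g≢f (uses-head-injective A′.levelled uses₁ (kf , f∈K′) (trans h (sym hf≡he))))
    exchanged-head-injective (inj₂ refl) (inj₁ (uses₂ , g≢f)) h =
      ⊥-elim (g≢f (uses-head-injective A′.levelled uses₂ (kf , f∈K′) (trans (sym h) (sym hf≡he))))
    exchanged-head-injective (inj₂ refl) (inj₂ refl) _ = refl

    -- If the K′-edge found crossing A is f, then either e crosses A, or the tail of e lies in A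
    -- and the K′-path from it to q, staying below depth k ≤ depth of f, crosses A by another edge.
    exchanged-meets-every-cut : MeetsEveryCut Exchanged
    exchanged-meets-every-cut A (a , a∈A) q∉A with depth-exists arb′ a
    ... | da , a-depth with crossing-edge-below A′.levelled q∉A da a-depth a∈A
    ... | i , g , g∈ , _ , h∈A , t∉A with g ≟ᶠ f
    ... | no g≢f = g , inj₁ ((i , g∈) , g≢f) , h∈A , t∉A
    ... | yes refl with tl e ∈? A
    ...   | no u∉A = e , inj₂ refl , subst (_∈ A) hf≡he h∈A , u∉A
    ...   | yes u∈A with crossing-edge-below A′.levelled q∉A d tail-e-depth′ u∈A
    ...     | i′ , g′ , g′∈ , i′≤d , crosses =
      g′ , inj₁ ((i′ , g′∈) , below-k⇒≢f (ℕ.≤-<-trans i′≤d d<k) g′∈) , crosses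

    exchanged-arborescence : ∃ λ K″ → IsArborescence K″ × (∀ {j g} → g ∈[ j ] K″ → Exchanged g)
    exchanged-arborescence = Growing.grow exchanged-meets-every-cut

    K″ : Levelling
    K″ = proj₁ exchanged-arborescence

    arb″ : IsArborescence K″
    arb″ = proj₁ (proj₂ exchanged-arborescence)

    within″ : ∀ {j g} → g ∈[ j ] K″ → Exchanged g
    within″ = proj₂ (proj₂ exchanged-arborescence)

    private
      module A″ = IsArborescence arb″

    uses″ : ∀ {g} → Exchanged g → Uses K″ g
    uses″ = uses-all-of-head-injective {K″} A″.covers within″ exchanged-head-injective

    K′→K″-shared : ∀ {j g} → toℕ j < toℕ k → g ∈[ j ] K′ → Uses K″ g
    K′→K″-shared j<k g∈ = uses″ (inj₁ ((_ , g∈) , below-k⇒≢f j<k g∈))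

    K′→K″-depth : ∀ {d w} → d < toℕ k → Depth K′ w d → Depth K″ w d
    K′→K″-depth = depth-transfer A′.levelled A″.levelled K′→K″-shared

    e∈K″ : e ∈[ k ] K″
    e∈K″ = entry-transfer A.levelled A″.levelled (λ d<k → K′→K″-depth d<k ∘ K→K′-depth d<k) e∈K (uses″ (inj₂ refl))

    K″→K′-shared : ∀ {j g} → toℕ j < toℕ k → g ∈[ j ] K″ → Uses K′ g
    K″→K′-shared j<k g∈ with within″ g∈
    ... | inj₁ (uses , _) = uses
    ... | inj₂ refl = ⊥-elim (ℕ.<-irrefl (cong toℕ (level-unique A″.levelled g∈ e∈K″)) j<k)

    K″→K′-depth : ∀ {d w} → d < toℕ k → Depth K″ w d → Depth K′ w d
    K″→K′-depth = depth-transfer A″.levelled A′.levelled K″→K′-shared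

    K″-precedes-K′ : FirstDifference K″ K′ k e
    K″-precedes-K′ = record
      { rows-agree    = λ j j<k → ⊆-antisym (entries-transfer-below A″.levelled A′.levelled K″→K′-shared j<k)
                                            (entries-transfer-below A′.levelled A″.levelled K′→K″-shared j<k)
      ; entries-agree = λ x x<e → lookup-ext (to x<e) (from x<e)
      ; e∈K           = e∈K″
      ; e∉K′          = e∉K′
      }
      where
      to : ∀ {x} → toℕ x < toℕ e → x ∈[ k ] K″ → x ∈[ k ] K′
      to x<e x∈ with within″ x∈
      ... | inj₁ (uses , _) = entry-transfer A″.levelled A′.levelled K″→K′-depth x∈ uses
      ... | inj₂ refl       = ⊥-elim (ℕ.<-irrefl refl x<e)
      from : ∀ {x} → toℕ x < toℕ e → x ∈[ k ] K′ → x ∈[ k ] K″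
      from {x} x<e x∈ = entry-transfer A′.levelled A″.levelled K′→K″-depth x∈ (uses″ (inj₁ ((k , x∈) , x≢f)))
        where
        x≢f : x ≢ f
        x≢f refl = f≢e (proj₂ (A.in-unique (∈-resp-lookup (sym (entries-agree f x<e)) x∈) e∈K hf≡he))

    e∈unused′ : e ∈ unused K′
    e∈unused′ = ∈-unused⁺ K′ e-unused

    e∉unused : e ∉ unused K
    e∉unused e∈ = ∈-unused⁻ K e∈ (k , e∈K)

    unused′-e⊆unused″ : unused K′ - e ⊆ unused K″
    unused′-e⊆unused″ {x} x∈ = ∈-unused⁺ K″ λ { (_ , x∈K″) → excluded (within″ x∈K″) }
      where
      excluded : ¬ Exchanged x
      excluded (inj₁ (uses , _)) = ∈-unused⁻ K′ (p─q⊆p (unused K′) ⁅ e ⁆ x∈) uses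
      excluded (inj₂ refl)       = x∉p-x (unused K′) e x∈

  depth? : ∀ K w d → Dec (Depth K w d)
  depth? K w d = map′ from to ((w ≟ᶠ q ×-dec d ℕ.≟ 0) ⊎-dec
                               any? λ k → any? λ e → (e ∈? lookup K k) ×-dec (hd e ≟ᶠ w) ×-dec (toℕ k ℕ.≟ d))
    where
    from : (w ≡ q × d ≡ 0) ⊎ (∃₂ λ k e → e ∈[ k ] K × hd e ≡ w × toℕ k ≡ d) → Depth K w d
    from (inj₁ (w≡q , d≡0))           = root w≡q d≡0
    from (inj₂ (_ , _ , e∈ , h , k≡)) = below e∈ h k≡
    to : Depth K w d → (w ≡ q × d ≡ 0) ⊎ (∃₂ λ k e → e ∈[ k ] K × hd e ≡ w × toℕ k ≡ d)
    to (root w≡q d≡0)  = inj₁ (w≡q , d≡0)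
    to (below e∈ h k≡) = inj₂ (_ , _ , e∈ , h , k≡)

  levelled? : ∀ K → Dec (IsLevelled K)
  levelled? K = map′ from to (in-unique? ×-dec parent?)
    where
    InUnique Parent : Set
    InUnique = ∀ k k′ e e′ → e ∈[ k ] K → e′ ∈[ k′ ] K → hd e ≡ hd e′ → k ≡ k′ × e ≡ e′
    Parent = ∀ k e → e ∈[ k ] K → toℕ k ≡ suc (pred (toℕ k)) × Depth K (tl e) (pred (toℕ k))
    in-unique? : Dec InUnique
    in-unique? = all? λ k → all? λ k′ → all? λ e → all? λ e′ →
      (e ∈? lookup K k) →-dec (e′ ∈? lookup K k′) →-dec (hd e ≟ᶠ hd e′) →-dec ((k ≟ᶠ k′) ×-dec (e ≟ᶠ e′))
    parent? : Dec Parent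
    parent? = all? λ k → all? λ e →
      (e ∈? lookup K k) →-dec ((toℕ k ℕ.≟ suc (pred (toℕ k))) ×-dec depth? K (tl e) (pred (toℕ k)))
    from : InUnique × Parent → IsLevelled K
    from (in-unique , parent) = record
      { in-unique = λ e∈ e′∈ h → in-unique _ _ _ _ e∈ e′∈ h
      ; parent    = λ {k} e∈ → pred (toℕ k) , parent k _ e∈
      }
    to : IsLevelled K → InUnique × Parent
    to levelled = (λ _ _ _ _ → in-unique) , parent′
      where
      open IsLevelled levelled
      parent′ : Parent
      parent′ k e e∈ with parent e∈
      ... | d , k≡ , tail-depth = trans k≡ (cong suc (sym pred-k≡d)) , subst (Depth K (tl e)) (sym pred-k≡d) tail-depth
        where
        pred-k≡d : pred (toℕ k) ≡ d
        pred-k≡d = cong pred k≡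

  arborescence? : ∀ K → Dec (IsArborescence K)
  arborescence? K = map′ (λ (levelled , covers) → record { levelled = levelled ; covers = covers })
                         (λ arb → IsArborescence.levelled arb , IsArborescence.covers arb)
                         (levelled? K ×-dec covers?)
    where
    covers? : Dec (Covers K)
    covers? = all? λ w → ¬? (w ≟ᶠ q) →-dec any? λ k → any? λ e → (e ∈? lookup K k) ×-dec (hd e ≟ᶠ w)

  _≺ᵇ_ : Bool → Bool → Set
  a ≺ᵇ b = a ≡ true × b ≡ false

  module Rows       = LexicographicEnumeration _≺ᵇ_
  module Levellings = LexicographicEnumeration (Rows._<ₗₑₓ_ {M})

  _≺_ : Levelling → Levelling → Set
  _≺_ = Levellings._<ₗₑₓ_

  ≺⇒first-difference : ∀ {K K′} → K ≺ K′ → ∃₂ (FirstDifference K K′)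
  ≺⇒first-difference {K} {K′} K≺K′ with Levellings.first-difference K≺K′
  ... | k , rows-agree , row≺ with Rows.first-difference row≺
  ... | e , entries-agree , (e∈ , e∉) = k , e , record
    { rows-agree    = rows-agree
    ; entries-agree = entries-agree
    ; e∈K           = lookup⇒[]= e (lookup K k) e∈
    ; e∉K′          = lookup≡false⇒∉ e∉
    }

  levellings : List Levelling
  levellings = Levellings.vectors (Rows.vectors (true ∷ false ∷ []) M) N

  -- Opaque so that the type checker never unfolds the enumeration of all levellings.
  opaque
    arborescences : List Levelling
    arborescences = filter arborescence? levellings

    arborescences-sorted : AllPairs _≺_ arborescences
    arborescences-sorted = AllPairs.filter⁺ arborescence? (Levellings.vectors-sorted (Rows.vectors-sorted true≺false M) N)
      where
      true≺false : AllPairs _≺ᵇ_ (true ∷ false ∷ [])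
      true≺false = ((refl , refl) All.∷ All.[]) ∷ All.[] ∷ []

    ∈-arborescences⁺ : ∀ {K} → IsArborescence K → K ∈ˡ arborescences
    ∈-arborescences⁺ {K} arb = ∈-filter⁺ arborescence? (Levellings.∈-vectors (Rows.∈-vectors ∈-bools) K) arb
      where
      ∈-bools : ∀ b → b ∈ˡ true ∷ false ∷ []
      ∈-bools true  = Any.here refl
      ∈-bools false = Any.there (Any.here refl)

    ∈-arborescences⁻ : ∀ {K} → K ∈ˡ arborescences → IsArborescence K
    ∈-arborescences⁻ K∈ = proj₂ (∈-filter⁻ arborescence? {xs = levellings} K∈)

  #arborescences : ℕ
  #arborescences = length arborescences

  arborescence : Fin #arborescences → Levelling
  arborescence = List.lookup arborescences

  arborescence-is : ∀ i → IsArborescence (arborescence i)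
  arborescence-is i = ∈-arborescences⁻ (∈-lookup i)

  arborescence-complete : ∀ {K} → IsArborescence K → ∃ λ i → arborescence i ≡ K
  arborescence-complete arb = Any.index K∈ , sym (lookup-index K∈)
    where
    K∈ = ∈-arborescences⁺ arb

  arborescence-sorted : ∀ {i j} → toℕ i < toℕ j → arborescence i ≺ arborescence j
  arborescence-sorted = AllPairs-lookup arborescences-sorted

  facet : Fin #arborescences → Subset M
  facet i = unused (arborescence i)

  first-difference⇒earlier : ∀ {l j k e} → FirstDifference (arborescence l) (arborescence j) k e → toℕ l < toℕ j
  first-difference⇒earlier {l} {j} diff with <-cmp l j
  ... | tri< l<j _ _ = l<j
  ... | tri≈ _ refl _ = ⊥-elim (first-difference-asym diff diff)
  ... | tri> _ _ j<l = ⊥-elim (first-difference-asym diff (proj₂ (proj₂ (≺⇒first-difference (arborescence-sorted j<l)))))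

  shelling-exchange : ∀ {i j} → toℕ i < toℕ j →
    ∃₂ λ e l → e ∈ facet j × e ∉ facet i × toℕ l < toℕ j × facet j - e ⊆ facet l
  shelling-exchange {i} {j} i<j with ≺⇒first-difference (arborescence-sorted i<j)
  ... | _ , e , diff with arborescence-complete E.arb″
    where
    module E = Exchange (arborescence-is i) (arborescence-is j) diff
  ... | l , l≡K″ = e , l , E.e∈unused′ , E.e∉unused , l<j , facet-j-e⊆facet-l
    where
    module E = Exchange (arborescence-is i) (arborescence-is j) diff
    l<j : toℕ l < toℕ j
    l<j = first-difference⇒earlier (subst (λ K → FirstDifference K (arborescence j) _ e) (sym l≡K″) E.K″-precedes-K′)
    facet-j-e⊆facet-l : facet j - e ⊆ facet l
    facet-j-e⊆facet-l = subst (λ K → facet j - e ⊆ unused K) (sym l≡K″) E.unused′-e⊆unused″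

  facets-complete : ∀ σ → IsFacet (SR G q) σ → ∃ λ i → facet i ≡ σ
  facets-complete σ isFacet with facet⇒unused isFacet
  ... | K , arb , unused≡σ with arborescence-complete arb
  ... | i , i≡K = i , trans (cong unused i≡K) unused≡σ

  facet-injective : Injective _≡_ _≡_ facet
  facet-injective {i} {j} facet-i≡j with <-cmp i j
  ... | tri< i<j _ _ with shelling-exchange i<j
  ...   | e , _ , e∈j , e∉i , _ = ⊥-elim (e∉i (subst (e ∈_) (sym facet-i≡j) e∈j))
  facet-injective {i} {j} facet-i≡j | tri≈ _ i≡j _ = i≡j
  facet-injective {i} {j} facet-i≡j | tri> _ _ j<i with shelling-exchange j<i
  ...   | e , _ , e∈i , e∉j , _ = ⊥-elim (e∉j (subst (e ∈_) facet-i≡j e∈i))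

  earlier-intersection-pure : ∀ j →
    PureCard (λ σ → σ ⊆ facet j × ∃ λ i → toℕ i < toℕ j × σ ⊆ facet i) (∣ facet j ∣ ∸ 1)
  earlier-intersection-pure j = bounded , extendable
    where
    inside-codim-one : ∀ {σ i} → toℕ i < toℕ j → σ ⊆ facet j → σ ⊆ facet i →
      ∃₂ λ e l → e ∈ facet j × toℕ l < toℕ j × facet j - e ⊆ facet l × σ ⊆ facet j - e
    inside-codim-one i<j σ⊆j σ⊆i with shelling-exchange i<j
    ... | e , l , e∈j , e∉i , l<j , j-e⊆l =
      e , l , e∈j , l<j , j-e⊆l , λ x∈σ → x∈p∧x≢y⇒x∈p-y (σ⊆j x∈σ) λ { refl → e∉i (σ⊆i x∈σ) }
    bounded : ∀ σ → σ ⊆ facet j × (∃ λ i → toℕ i < toℕ j × σ ⊆ facet i) → ∣ σ ∣ ≤ ∣ facet j ∣ ∸ 1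
    bounded σ (σ⊆j , i , i<j , σ⊆i) with inside-codim-one i<j σ⊆j σ⊆i
    ... | _ , _ , e∈j , _ , _ , σ⊆j-e = subst (∣ σ ∣ ≤_) (x∈p⇒∣p-x∣≡∣p∣∸1 e∈j) (p⊆q⇒∣p∣≤∣q∣ σ⊆j-e)
    extendable : ∀ σ → σ ⊆ facet j × (∃ λ i → toℕ i < toℕ j × σ ⊆ facet i) →
      ∃ λ τ → (τ ⊆ facet j × ∃ λ i → toℕ i < toℕ j × τ ⊆ facet i) × σ ⊆ τ × ∣ τ ∣ ≡ ∣ facet j ∣ ∸ 1
    extendable σ (σ⊆j , i , i<j , σ⊆i) with inside-codim-one i<j σ⊆j σ⊆i
    ... | e , l , e∈j , l<j , j-e⊆l , σ⊆j-e =
      facet j - e , (p─q⊆p (facet j) ⁅ e ⁆ , l , l<j , j-e⊆l) , σ⊆j-e , x∈p⇒∣p-x∣≡∣p∣∸1 e∈j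

lemma4p8 : (G : DiGraph) (q : Fin (n G)) → IsSource G q →
    (∀ v → Reachable G q v) → Shellable (SR G q)
lemma4p8 G q q-source _ =
  #arborescences , facet , (λ i → unused-facet (arborescence-is i)) , facets-complete , facet-injective ,
  (λ j _ → earlier-intersection-pure j)
  where
  open Arborescences G q q-source
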